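{- Let $0\le a\le 2^n$ and $m(I_a)=(m_0,m_1,\ldots,m_{n-1})$. Then $m_0\le m_1\le\cdots\le m_{n-1}$.
   Context: $Q_n=\{0,1\}^n$ is the set of binary strings $x_0x_1\ldots x_{n-1}$, identified with the integer $\sum_i x_i2^{n-1-i}$. $I_a\subseteq Q_n$ is the set of strings with integer value $<a$. For $S\subseteq Q_n$, $m_i(S)$ is the number of $x\in S$ with $x_i=1$, and $m(S)=(m_0(S),\ldots,m_{n-1}(S))$. -}

module Defs where

open import Data.Nat using (ℕ; zero; suc; _+_; _*_; _<_; _<ᵇ_)
open import Data.Bool using (Bool; true; false; if_then_else_)
open import Data.Vec using (Vec; []; _∷_; lookup)
open import Data.List using (List; []; _∷_; map; _++_; filterᵇ; length)
open import Data.Fin using (Fin)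

Q : (n : ℕ) → List (Vec Bool n)
Q zero    = [] ∷ []
Q (suc n) = map (false ∷_) (Q n) ++ map (true ∷_) (Q n)

-- integer value of x_0 x_1 ... x_{n-1}, i.e. sum_i x_i 2^{n-1-i} (x_0 most significant)
bit : Bool → ℕ
bit false = 0
bit true  = 1

valAcc : {n : ℕ} → ℕ → Vec Bool n → ℕ
valAcc acc []       = acc
valAcc acc (b ∷ xs) = valAcc (2 * acc + bit b) xs

val : {n : ℕ} → Vec Bool n → ℕ
val = valAcc 0

I : (n a : ℕ) → List (Vec Bool n)
I n a = filterᵇ (λ x → val x <ᵇ a) (Q n)

m : {n : ℕ} → Fin n → List (Vec Bool n) → ℕ
m i S = length (filterᵇ (λ x → lookup x i) S)

{-# OPTIONS --safe #-}
module Submission where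

-- Splitting Q_{n+1} by the leading bit, I_a = 0·I_a ∪ 1·I_{a-2^n} (in Q_n), hence
-- m_{i+1}(I_a) = m_i(I_a) + m_i(I_{a-2^n}) one dimension lower, and the claim for
-- (i+1, i+2) follows from the claim for (i, i+1).  The base pair (0, 1) in Q_{n+2}
-- reduces to |I_{a-2^{n+1}}| ≤ |I_{a-2^n}| in Q_n, i.e. to |I_b| being monotone in b.

open import Defs
open import Data.Nat using (ℕ; zero; suc; _+_; _*_; _∸_; _^_; _≤_; _<ᵇ_; z≤n; s≤s)
open import Data.Nat.Properties
  using (*-identityˡ; *-identityʳ; *-assoc; *-comm; *-distribˡ-+; +-assoc; +-mono-≤;
         ∸-monoˡ-≤; ∸-monoʳ-≤; m≤m+n; ≤-refl; suc-injective; module ≤-Reasoning)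
open import Data.Bool using (Bool; true; false)
open import Data.Fin using (Fin; zero; suc; toℕ)
open import Data.Vec using (Vec; []; _∷_; lookup)
open import Data.List using (List; []; _∷_; map; _++_; filterᵇ; length)
open import Data.List.Properties using (filter-++; length-++; length-map)
open import Function using (_∘_)
open import Relation.Binary.PropositionalEquality
  using (_≡_; refl; sym; trans; cong; cong₂; _≗_; module ≡-Reasoning)

filterᵇ-map : {A B : Set} (p : B → Bool) (f : A → B) (xs : List A) →
              filterᵇ p (map f xs) ≡ map f (filterᵇ (p ∘ f) xs)
filterᵇ-map p f []       = refl
filterᵇ-map p f (x ∷ xs) with p (f x)
... | true  = cong (f x ∷_) (filterᵇ-map p f xs)
... | false = filterᵇ-map p f xs

filterᵇ-cong : {A : Set} {p q : A → Bool} → p ≗ q → filterᵇ p ≗ filterᵇ q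
filterᵇ-cong         p≗q []       = refl
filterᵇ-cong {q = q} p≗q (x ∷ xs) rewrite p≗q x with q x
... | true  = cong (x ∷_) (filterᵇ-cong p≗q xs)
... | false = filterᵇ-cong p≗q xs

+-<ᵇ-∸ : ∀ k v a → (k + v <ᵇ a) ≡ (v <ᵇ a ∸ k)
+-<ᵇ-∸ zero    v       a       = refl
+-<ᵇ-∸ (suc k) zero    zero    = refl
+-<ᵇ-∸ (suc k) (suc v) zero    = refl
+-<ᵇ-∸ (suc k) v       (suc a) = +-<ᵇ-∸ k v a

valAcc-+ : ∀ {n} p q (xs : Vec Bool n) → valAcc (p + q) xs ≡ p * 2 ^ n + valAcc q xs
valAcc-+ p q []                = cong (_+ q) (sym (*-identityʳ p))
valAcc-+ {suc n} p q (b ∷ xs) = begin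
  valAcc (2 * (p + q) + bit b) xs            ≡⟨ cong (λ acc → valAcc acc xs) shift ⟩
  valAcc (2 * p + (2 * q + bit b)) xs        ≡⟨ valAcc-+ (2 * p) (2 * q + bit b) xs ⟩
  2 * p * 2 ^ n + valAcc (2 * q + bit b) xs  ≡⟨ cong (_+ valAcc (2 * q + bit b) xs) scale ⟩
  p * 2 ^ suc n + valAcc (2 * q + bit b) xs  ∎
  where
  open ≡-Reasoning
  shift : 2 * (p + q) + bit b ≡ 2 * p + (2 * q + bit b)
  shift = trans (cong (_+ bit b) (*-distribˡ-+ 2 p q)) (+-assoc (2 * p) (2 * q) (bit b))
  scale : 2 * p * 2 ^ n ≡ p * (2 * 2 ^ n)
  scale = trans (cong (_* 2 ^ n) (*-comm 2 p)) (*-assoc p 2 (2 ^ n))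

val-true∷ : ∀ {n} (x : Vec Bool n) → val (true ∷ x) ≡ 2 ^ n + val x
val-true∷ {n} x = trans (valAcc-+ 1 0 x) (cong (_+ val x) (*-identityˡ (2 ^ n)))

I-suc : ∀ n a → I (suc n) a ≡ map (false ∷_) (I n a) ++ map (true ∷_) (I n (a ∸ 2 ^ n))
I-suc n a = begin
  filterᵇ below-a (map (false ∷_) (Q n) ++ map (true ∷_) (Q n))
    ≡⟨ filter-++ _ (map (false ∷_) (Q n)) (map (true ∷_) (Q n)) ⟩
  filterᵇ below-a (map (false ∷_) (Q n)) ++ filterᵇ below-a (map (true ∷_) (Q n))
    ≡⟨ cong₂ _++_ (filterᵇ-map below-a (false ∷_) (Q n)) (filterᵇ-map below-a (true ∷_) (Q n)) ⟩
  map (false ∷_) (I n a) ++ map (true ∷_) (filterᵇ (below-a ∘ (true ∷_)) (Q n))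
    ≡⟨ cong (λ S → map (false ∷_) (I n a) ++ map (true ∷_) S) (filterᵇ-cong shifted (Q n)) ⟩
  map (false ∷_) (I n a) ++ map (true ∷_) (I n (a ∸ 2 ^ n)) ∎
  where
  open ≡-Reasoning
  below-a : Vec Bool (suc n) → Bool
  below-a x = val x <ᵇ a
  shifted : (λ x → val (true ∷ x) <ᵇ a) ≗ (λ x → val x <ᵇ a ∸ 2 ^ n)
  shifted x = trans (cong (_<ᵇ a) (val-true∷ x)) (+-<ᵇ-∸ (2 ^ n) (val x) a)

length-I-suc : ∀ n a → length (I (suc n) a) ≡ length (I n a) + length (I n (a ∸ 2 ^ n))
length-I-suc n a = begin
  length (I (suc n) a)
    ≡⟨ cong length (I-suc n a) ⟩
  length (map (false ∷_) (I n a) ++ map (true ∷_) (I n (a ∸ 2 ^ n)))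
    ≡⟨ length-++ (map (false ∷_) (I n a)) ⟩
  length (map (false ∷_) (I n a)) + length (map (true ∷_) (I n (a ∸ 2 ^ n)))
    ≡⟨ cong₂ _+_ (length-map (false ∷_) (I n a)) (length-map (true ∷_) (I n (a ∸ 2 ^ n))) ⟩
  length (I n a) + length (I n (a ∸ 2 ^ n)) ∎
  where open ≡-Reasoning

length-I-mono : ∀ n {b c} → b ≤ c → length (I n b) ≤ length (I n c)
length-I-mono zero    {zero}  {c}     b≤c       = z≤n
length-I-mono zero    {suc b} {suc c} (s≤s b≤c) = ≤-refl
length-I-mono (suc n) {b}     {c}     b≤c
  rewrite length-I-suc n b | length-I-suc n c =
  +-mono-≤ (length-I-mono n b≤c) (length-I-mono n (∸-monoˡ-≤ (2 ^ n) b≤c))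

m-++ : ∀ {n} (i : Fin n) S T → m i (S ++ T) ≡ m i S + m i T
m-++ i S T = trans (cong length (filter-++ _ S T)) (length-++ (filterᵇ _ S))

m-suc-∷ : ∀ {n} (i : Fin n) b S → m (suc i) (map (b ∷_) S) ≡ m i S
m-suc-∷ i b S =
  trans (cong length (filterᵇ-map _ (b ∷_) S)) (length-map (b ∷_) (filterᵇ (λ x → lookup x i) S))

m-zero-false∷ : ∀ {n} (S : List (Vec Bool n)) → m zero (map (false ∷_) S) ≡ 0
m-zero-false∷ []      = refl
m-zero-false∷ (_ ∷ S) = m-zero-false∷ S

m-zero-true∷ : ∀ {n} (S : List (Vec Bool n)) → m zero (map (true ∷_) S) ≡ length S
m-zero-true∷ []      = refl
m-zero-true∷ (_ ∷ S) = cong suc (m-zero-true∷ S)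

m-suc-I : ∀ n (i : Fin n) a → m (suc i) (I (suc n) a) ≡ m i (I n a) + m i (I n (a ∸ 2 ^ n))
m-suc-I n i a = begin
  m (suc i) (I (suc n) a)
    ≡⟨ cong (m (suc i)) (I-suc n a) ⟩
  m (suc i) (map (false ∷_) (I n a) ++ map (true ∷_) (I n (a ∸ 2 ^ n)))
    ≡⟨ m-++ (suc i) (map (false ∷_) (I n a)) _ ⟩
  m (suc i) (map (false ∷_) (I n a)) + m (suc i) (map (true ∷_) (I n (a ∸ 2 ^ n)))
    ≡⟨ cong₂ _+_ (m-suc-∷ i false (I n a)) (m-suc-∷ i true (I n (a ∸ 2 ^ n))) ⟩
  m i (I n a) + m i (I n (a ∸ 2 ^ n)) ∎
  where open ≡-Reasoning

m-zero-I : ∀ n a → m zero (I (suc n) a) ≡ length (I n (a ∸ 2 ^ n))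
m-zero-I n a = begin
  m zero (I (suc n) a)
    ≡⟨ cong (m zero) (I-suc n a) ⟩
  m zero (map (false ∷_) (I n a) ++ map (true ∷_) (I n (a ∸ 2 ^ n)))
    ≡⟨ m-++ zero (map (false ∷_) (I n a)) _ ⟩
  m zero (map (false ∷_) (I n a)) + m zero (map (true ∷_) (I n (a ∸ 2 ^ n)))
    ≡⟨ cong₂ _+_ (m-zero-false∷ (I n a)) (m-zero-true∷ (I n (a ∸ 2 ^ n))) ⟩
  length (I n (a ∸ 2 ^ n)) ∎
  where open ≡-Reasoning

m-zero-I≤m-one-I : ∀ n a → m zero (I (suc (suc n)) a) ≤ m (suc zero) (I (suc (suc n)) a)
m-zero-I≤m-one-I n a = begin
  m zero (I (suc (suc n)) a)
    ≡⟨ m-zero-I (suc n) a ⟩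
  length (I (suc n) (a ∸ 2 ^ suc n))
    ≡⟨ length-I-suc n (a ∸ 2 ^ suc n) ⟩
  length (I n (a ∸ 2 ^ suc n)) + length (I n (a ∸ 2 ^ suc n ∸ 2 ^ n))
    ≤⟨ +-mono-≤ (length-I-mono n (∸-monoʳ-≤ a (m≤m+n (2 ^ n) (2 ^ n + 0)))) ≤-refl ⟩
  length (I n (a ∸ 2 ^ n)) + length (I n (a ∸ 2 ^ suc n ∸ 2 ^ n))
    ≡⟨ sym (cong₂ _+_ (m-zero-I n a) (m-zero-I n (a ∸ 2 ^ suc n))) ⟩
  m zero (I (suc n) a) + m zero (I (suc n) (a ∸ 2 ^ suc n))
    ≡⟨ sym (m-suc-I (suc n) zero a) ⟩
  m (suc zero) (I (suc (suc n)) a) ∎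
  where open ≤-Reasoning

m-I-mono-adjacent : ∀ n a (i j : Fin n) → toℕ j ≡ suc (toℕ i) → m i (I n a) ≤ m j (I n a)
m-I-mono-adjacent (suc (suc n)) a zero    (suc zero)    refl = m-zero-I≤m-one-I n a
m-I-mono-adjacent (suc n)       a (suc i) (suc j)       j≡1+i
  rewrite m-suc-I n i a | m-suc-I n j a =
  +-mono-≤ (m-I-mono-adjacent n a i j (suc-injective j≡1+i))
           (m-I-mono-adjacent n (a ∸ 2 ^ n) i j (suc-injective j≡1+i))

mainTheorem15 : (n a : ℕ) → a ≤ 2 ^ n → (i j : Fin n) → toℕ j ≡ suc (toℕ i) →
                m i (I n a) ≤ m j (I n a)
mainTheorem15 n a _ = m-I-mono-adjacent n a
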